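{- Let $K$ be an absorptive, fully-continuous semiring. Then all elements $a,b,c \in K$ satisfy: \[ c + ab \ge b \quad\implies\quad c + a^\infty b \ge b. \]
   Context: A commutative semiring $(K,+,\cdot,0,1)$ is absorptive if $1+a=1$ for all $a$; $\le$ is the natural order ($a\le b$ iff $a+b=b$). It is fully continuous if $\le$ is a complete lattice and for all $a$, all nonempty chains $C$ and $\circ\in\{+,\cdot\}$: $\sup(a\circ C)=a\circ\sup C$ and $\inf(a\circ C)=a\circ\inf C$. The infinitary power is $a^\infty:=\inf_{n\in\mathbb{N}}a^n$ (infimum w.r.t. $\le$). -}

module Defs where

open import Level using (Level; _⊔_; Lift) renaming (suc to lsuc)
open import Algebra.Bundles using (CommutativeSemiring)
open import Data.Nat.Base using (ℕ)
open import Data.Product using (Σ; ∃; _×_; _,_)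
open import Data.Sum.Base using (_⊎_)

module _ {c ℓ : Level} (K : CommutativeSemiring c ℓ) where
  open CommutativeSemiring K
  open import Algebra.Definitions.RawSemiring rawSemiring using (_^_)

  _≤K_ : Carrier → Carrier → Set ℓ
  a ≤K b = (a + b) ≈ b

  Absorptive : Set (c ⊔ ℓ)
  Absorptive = ∀ a → (1# + a) ≈ 1#

  Subset : Set (c ⊔ lsuc (c ⊔ ℓ))
  Subset = Carrier → Set (c ⊔ ℓ)

  IsSup : Subset → Carrier → Set (c ⊔ ℓ)
  IsSup P s = (∀ x → P x → x ≤K s) × (∀ u → (∀ x → P x → x ≤K u) → s ≤K u)

  IsInf : Subset → Carrier → Set (c ⊔ ℓ)
  IsInf P s = (∀ x → P x → s ≤K x) × (∀ u → (∀ x → P x → u ≤K x) → u ≤K s)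

  IsNonemptyChain : Subset → Set (c ⊔ ℓ)
  IsNonemptyChain C = (∃ λ x → C x) × (∀ x y → C x → C y → (x ≤K y) ⊎ (y ≤K x))

  image : (Carrier → Carrier → Carrier) → Carrier → Subset → Subset
  image _∘_ a C y = ∃ λ x → C x × (y ≈ (a ∘ x))

  record FullyContinuous : Set (lsuc (c ⊔ ℓ)) where
    field
      ⨆ : Subset → Carrier
      ⨆-isSup : ∀ P → IsSup P (⨆ P)
      ⨅ : Subset → Carrier
      ⨅-isInf : ∀ P → IsInf P (⨅ P)
      sup-+ : ∀ a C → IsNonemptyChain C → ⨆ (image _+_ a C) ≈ (a + ⨆ C)
      sup-* : ∀ a C → IsNonemptyChain C → ⨆ (image _*_ a C) ≈ (a * ⨆ C)
      inf-+ : ∀ a C → IsNonemptyChain C → ⨅ (image _+_ a C) ≈ (a + ⨅ C)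
      inf-* : ∀ a C → IsNonemptyChain C → ⨅ (image _*_ a C) ≈ (a * ⨅ C)

    _^∞ : Carrier → Carrier
    a ^∞ = ⨅ (λ y → Lift c (∃ λ (n : ℕ) → y ≈ (a ^ n)))

{-# OPTIONS --safe #-}
module Submission where

-- The hypothesis says that b is a post-fixed point of x ↦ c′ + a x.  Absorption gives
-- a c′ ≤ c′, so iterating yields b ≤ c′ + aⁿ b for every n.  The powers aⁿ form a
-- descending chain, and full continuity lets the infimum over n pass through
-- x ↦ c′ + x b, giving b ≤ c′ + a^∞ b.

open import Defs
open import Level using (Level; Lift; lift)
open import Algebra.Bundles using (CommutativeSemiring)
open import Data.Nat.Base as ℕ using (ℕ; zero; suc; z≤n; s≤s)
open import Data.Nat.Properties as ℕ using ()
open import Data.Product using (∃; _,_; proj₂)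
open import Data.Sum.Base as Sum using (_⊎_)

module NaturalOrder {c ℓ : Level} (K : CommutativeSemiring c ℓ) where
  open CommutativeSemiring K
  open import Relation.Binary.Reasoning.Setoid setoid

  infix 4 _≤_
  _≤_ : Carrier → Carrier → Set ℓ
  _≤_ = _≤K_ K

  ≤-trans : ∀ {x y z} → x ≤ y → y ≤ z → x ≤ z
  ≤-trans {x} {y} {z} x≤y y≤z = begin
    x + z       ≈⟨ +-congˡ y≤z ⟨
    x + (y + z) ≈⟨ +-assoc x y z ⟨
    (x + y) + z ≈⟨ +-congʳ x≤y ⟩
    y + z       ≈⟨ y≤z ⟩
    z           ∎

  ≤-resp-≈ : ∀ {x x′ y y′} → x ≈ x′ → y ≈ y′ → x ≤ y → x′ ≤ y′
  ≤-resp-≈ {x} {x′} {y} {y′} x≈x′ y≈y′ x≤y = begin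
    x′ + y′ ≈⟨ +-cong x≈x′ y≈y′ ⟨
    x + y   ≈⟨ x≤y ⟩
    y       ≈⟨ y≈y′ ⟩
    y′      ∎

  *-monoˡ-≤ : ∀ z {x y} → x ≤ y → z * x ≤ z * y
  *-monoˡ-≤ z {x} {y} x≤y = begin
    z * x + z * y ≈⟨ distribˡ z x y ⟨
    z * (x + y)   ≈⟨ *-congˡ x≤y ⟩
    z * y         ∎

module AbsorptiveOrder {c ℓ : Level} (K : CommutativeSemiring c ℓ) (absorptive : Absorptive K) where
  open CommutativeSemiring K hiding (zero)
  open import Algebra.Definitions.RawSemiring rawSemiring using (_^_)
  open import Algebra.Properties.CommutativeSemigroup +-commutativeSemigroup
    using (interchange; x∙yz≈y∙xz)
  open import Relation.Binary.Reasoning.Setoid setoid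
  open NaturalOrder K

  +-idem : ∀ x → x + x ≈ x
  +-idem x = begin
    x + x             ≈⟨ +-cong (*-identityˡ x) (*-identityˡ x) ⟨
    1# * x + 1# * x   ≈⟨ distribʳ x 1# 1# ⟨
    (1# + 1#) * x     ≈⟨ *-congʳ (absorptive 1#) ⟩
    1# * x            ≈⟨ *-identityˡ x ⟩
    x                 ∎

  ≤-reflexive : ∀ {x y} → x ≈ y → x ≤ y
  ≤-reflexive {x} x≈y = ≤-resp-≈ refl x≈y (+-idem x)

  x*y≤y : ∀ x y → x * y ≤ y
  x*y≤y x y = begin
    x * y + y       ≈⟨ +-congˡ (*-identityˡ y) ⟨
    x * y + 1# * y  ≈⟨ distribʳ y x 1# ⟨
    (x + 1#) * y    ≈⟨ *-congʳ (+-comm x 1#) ⟩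
    (1# + x) * y    ≈⟨ *-congʳ (absorptive x) ⟩
    1# * y          ≈⟨ *-identityˡ y ⟩
    y               ∎

  x≤y+x : ∀ x y → x ≤ y + x
  x≤y+x x y = begin
    x + (y + x) ≈⟨ x∙yz≈y∙xz x y x ⟩
    y + (x + x) ≈⟨ +-congˡ (+-idem x) ⟩
    y + x       ∎

  +-monoˡ-≤ : ∀ z {x y} → x ≤ y → z + x ≤ z + y
  +-monoˡ-≤ z {x} {y} x≤y = begin
    (z + x) + (z + y) ≈⟨ interchange z x z y ⟩
    (z + z) + (x + y) ≈⟨ +-cong (+-idem z) x≤y ⟩
    z + y             ∎

  ^-antitone : ∀ a {m n} → m ℕ.≤ n → a ^ n ≤ a ^ m
  ^-antitone a {zero}  {zero}  z≤n       = ≤-reflexive refl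
  ^-antitone a {zero}  {suc n} z≤n       = ≤-trans (x*y≤y a (a ^ n)) (^-antitone a (z≤n {n}))
  ^-antitone a {suc m} {suc n} (s≤s m≤n) = *-monoˡ-≤ a (^-antitone a m≤n)

  postFixed-^ : ∀ a b c′ → b ≤ c′ + a * b → ∀ n → b ≤ c′ + a ^ n * b
  postFixed-^ a b c′ post zero =
    ≤-resp-≈ refl (+-congˡ (sym (*-identityˡ b))) (x≤y+x b c′)
  postFixed-^ a b c′ post (suc n) =
    ≤-trans post (≤-trans (+-monoˡ-≤ c′ (*-monoˡ-≤ a (postFixed-^ a b c′ post n)))
                          (≤-reflexive unfold))
    where
    unfold : c′ + a * (c′ + a ^ n * b) ≈ c′ + a ^ suc n * b
    unfold = begin
      c′ + a * (c′ + a ^ n * b)        ≈⟨ +-congˡ (distribˡ a c′ _) ⟩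
      c′ + (a * c′ + a * (a ^ n * b))  ≈⟨ +-assoc c′ _ _ ⟨
      (c′ + a * c′) + a * (a ^ n * b)  ≈⟨ +-cong (+-comm c′ _) (sym (*-assoc a _ b)) ⟩
      (a * c′ + c′) + a ^ suc n * b    ≈⟨ +-congʳ (x*y≤y a c′) ⟩
      c′ + a ^ suc n * b               ∎

  -- chosen so that  a ^∞  is definitionally  ⨅ (powers a)
  powers : Carrier → Subset K
  powers a y = Lift c (∃ λ (n : ℕ) → y ≈ a ^ n)

  powers-chain : ∀ a → IsNonemptyChain K (powers a)
  powers-chain a = (1# , lift (0 , refl)) , comparable
    where
    comparable : ∀ x y → powers a x → powers a y → x ≤ y ⊎ y ≤ x
    comparable x y (lift (m , x≈aᵐ)) (lift (n , y≈aⁿ)) = Sum.map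
      (λ n≤m → ≤-resp-≈ (sym x≈aᵐ) (sym y≈aⁿ) (^-antitone a n≤m))
      (λ m≤n → ≤-resp-≈ (sym y≈aⁿ) (sym x≈aᵐ) (^-antitone a m≤n))
      (ℕ.≤-total n m)

module ChainContinuity {c ℓ : Level} (K : CommutativeSemiring c ℓ) (FC : FullyContinuous K) where
  open CommutativeSemiring K
  open FullyContinuous FC
  open import Relation.Binary.Reasoning.Setoid setoid
  open NaturalOrder K

  *-image-chain : ∀ b C → IsNonemptyChain K C → IsNonemptyChain K (image K _*_ b C)
  *-image-chain b C ((x , x∈C) , comparable) = (b * x , x , x∈C , refl) , comparable′
    where
    comparable′ : ∀ y z → image K _*_ b C y → image K _*_ b C z → y ≤ z ⊎ z ≤ y
    comparable′ y z (u , u∈C , y≈bu) (v , v∈C , z≈bv) = Sum.map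
      (λ u≤v → ≤-resp-≈ (sym y≈bu) (sym z≈bv) (*-monoˡ-≤ b u≤v))
      (λ v≤u → ≤-resp-≈ (sym z≈bv) (sym y≈bu) (*-monoˡ-≤ b v≤u))
      (comparable u v u∈C v∈C)

  ≤-⨅ : ∀ P {u} → (∀ x → P x → u ≤ x) → u ≤ ⨅ P
  ≤-⨅ P {u} = proj₂ (⨅-isInf P) u

  ≤-+*-⨅ : ∀ c′ b C {u} → IsNonemptyChain K C →
           (∀ x → C x → u ≤ c′ + b * x) → u ≤ c′ + b * ⨅ C
  ≤-+*-⨅ c′ b C {u} chain bound =
    ≤-resp-≈ refl ⨅-affine (≤-⨅ (image K _+_ c′ (image K _*_ b C)) bound′)
    where
    bound′ : ∀ x → image K _+_ c′ (image K _*_ b C) x → u ≤ x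
    bound′ x (y , (z , z∈C , y≈bz) , x≈c′+y) =
      ≤-resp-≈ refl (sym (trans x≈c′+y (+-congˡ y≈bz))) (bound z z∈C)
    ⨅-affine : ⨅ (image K _+_ c′ (image K _*_ b C)) ≈ c′ + b * ⨅ C
    ⨅-affine = begin
      ⨅ (image K _+_ c′ (image K _*_ b C)) ≈⟨ inf-+ c′ _ (*-image-chain b C chain) ⟩
      c′ + ⨅ (image K _*_ b C)             ≈⟨ +-congˡ (inf-* b C chain) ⟩
      c′ + b * ⨅ C                         ∎

lemma33 : {c ℓ : Level} (K : CommutativeSemiring c ℓ) → Absorptive K → (FC : FullyContinuous K) →
    let open CommutativeSemiring K
        open FullyContinuous FC
    in ∀ a b c′ → _≤K_ K b (c′ + (a * b)) → _≤K_ K b (c′ + ((a ^∞) * b))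
lemma33 K absorptive FC a b c′ post =
  ≤-resp-≈ refl (+-congˡ (*-comm b (a ^∞)))
    (≤-+*-⨅ c′ b (powers a) (powers-chain a) b≤c′+b*aⁿ)
  where
  open CommutativeSemiring K
  open FullyContinuous FC
  open NaturalOrder K
  open AbsorptiveOrder K absorptive
  open ChainContinuity K FC

  b≤c′+b*aⁿ : ∀ x → powers a x → b ≤ c′ + b * x
  b≤c′+b*aⁿ x (lift (n , x≈aⁿ)) =
    ≤-resp-≈ refl (+-congˡ (trans (*-comm _ b) (*-congˡ (sym x≈aⁿ)))) (postFixed-^ a b c′ post n)
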